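{- Let $G$ be a graph, let $K$ be a copy of $K_6$ in $G$ and let $e\in E(K)$. Then for every $f\in E(G)$, $$\sum_{T\in\mathcal K_4(G):\, f\in E(T)}\psi_{K,e}(T)=\begin{cases}1,& f=e,\\ 0,&\text{otherwise.}\end{cases}$$
   Context: $\mathcal K_4(G)$ is the set of copies of $K_4$ in $G$. For a copy $K$ of $K_6$ in $G$ and an edge $e$ of $K$, the edge-gadget $\psi_{K,e}:\mathcal K_4(G)\to\mathbb R$ is defined by: $\psi_{K,e}(T)=\frac12$ if $T\subseteq K$ and $e\cap V(T)=\emptyset$; $\psi_{K,e}(T)=-\frac16$ if $T\subseteq K$ and $|e\cap V(T)|=1$; $\psi_{K,e}(T)=\frac16$ if $T\subseteq K$ and $e\in E(T)$; and $\psi_{K,e}(T)=0$ otherwise (here $T\subseteq K$ means $T$ is a subgraph of $K$, and edges are viewed as 2-element vertex sets). -}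

module Defs where

open import Data.Nat using (ℕ; zero; suc; _+_)
open import Data.Integer using (+_)
open import Data.Rational using (ℚ; 0ℚ; 1ℚ; ½; _/_; -_) renaming (_+_ to _+ℚ_)
open import Data.Fin using (Fin; _≟_)
open import Data.Fin.Properties using (all?)
open import Data.Fin.Subset using (Subset; _∈_; _⊆_; ∣_∣; outside; inside)
open import Data.Fin.Subset.Properties using (_∈?_; _⊆?_)
open import Data.Vec using (_∷_; [])
open import Data.List using (List; []; _∷_; map; _++_; filter; foldr)
open import Data.Product using (_×_)
open import Relation.Binary using (Decidable; Symmetric)
open import Relation.Binary.PropositionalEquality using (_≡_)
open import Relation.Nullary using (Dec; yes; no; ¬_)
open import Relation.Nullary.Decidable using (_×-dec_; _→-dec_; ¬?)
import Data.Nat.Properties as ℕP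

record Graph (n : ℕ) : Set₁ where
  field
    Adj    : Fin n → Fin n → Set
    adj?   : Decidable Adj
    sym    : Symmetric Adj
    irrefl : ∀ {i} → ¬ Adj i i
open Graph public

allSubsets : (n : ℕ) → List (Subset n)
allSubsets zero = [] ∷ []
allSubsets (suc n) = map (outside ∷_) (allSubsets n) ++ map (inside ∷_) (allSubsets n)

IsClique : ∀ {n} → Graph n → Subset n → Set
IsClique G S = ∀ i j → i ∈ S → j ∈ S → ¬ i ≡ j → Adj G i j

isClique? : ∀ {n} (G : Graph n) (S : Subset n) → Dec (IsClique G S)
isClique? G S = all? λ i → all? λ j →
  (i ∈? S) →-dec (j ∈? S) →-dec ¬? (i ≟ j) →-dec adj? G i j

-- A copy of K_r in G (simple graph) is determined by its vertex set:
-- an r-element clique.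
IsCopyOfK : ∀ {n} → ℕ → Graph n → Subset n → Set
IsCopyOfK r G S = ∣ S ∣ ≡ r × IsClique G S

isCopyOfK? : ∀ {n} r (G : Graph n) (S : Subset n) → Dec (IsCopyOfK r G S)
isCopyOfK? r G S = (∣ S ∣ ℕP.≟ r) ×-dec isClique? G S

K4s : ∀ {n} → Graph n → List (Subset n)
K4s {n} G = filter (isCopyOfK? 4 G) (allSubsets n)

-- an edge {u,v} lies in E(T) (T a clique, given by its vertex set)
EdgeIn : ∀ {n} → Fin n → Fin n → Subset n → Set
EdgeIn u v T = u ∈ T × v ∈ T

edgeIn? : ∀ {n} (u v : Fin n) (T : Subset n) → Dec (EdgeIn u v T)
edgeIn? u v T = (u ∈? T) ×-dec (v ∈? T)

-- |e ∩ V(T)| for e = {x,y}, x ≠ y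
ind : ∀ {n} → Fin n → Subset n → ℕ
ind x T with x ∈? T
... | yes _ = 1
... | no _  = 0

meet : ∀ {n} → Fin n → Fin n → Subset n → ℕ
meet x y T = ind x T + ind y T

gadgetValue : ℕ → ℚ
gadgetValue 0 = ½
gadgetValue 1 = - (+ 1 / 6)
gadgetValue 2 = + 1 / 6
gadgetValue _ = 0ℚ

-- edge-gadget ψ_{K,e}(T), e = {x,y}; T ⊆ K means V(T) ⊆ V(K)
-- (as K is complete, this is the same as T being a subgraph of K)
ψ : ∀ {n} (K : Subset n) (x y : Fin n) → Subset n → ℚ
ψ K x y T with T ⊆? K
... | yes _ = gadgetValue (meet x y T)
... | no _  = 0ℚ

sumℚ : List ℚ → ℚ
sumℚ = foldr _+ℚ_ 0ℚ

gadgetSum : ∀ {n} (G : Graph n) (K : Subset n) (x y u v : Fin n) → ℚ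
gadgetSum G K x y u v = sumℚ (map (ψ K x y) (filter (edgeIn? u v) (K4s G)))

{-# OPTIONS --safe #-}
-- ψ_{K,e}(T) vanishes unless T ⊆ K, and for T ⊆ K inclusion–exclusion over e ∩ V(T) gives
--   ψ_{K,e}(T) = ½ − ⅔ [x ∈ T] − ⅔ [y ∈ T] + [x ∈ T][y ∈ T].
-- As K is a clique, its 4-subsets are exactly the copies of K₄ inside K, so summing over the
-- copies through f = {u, v} gives
--   ½ N(f) − ⅔ N(f ∪ {x}) − ⅔ N(f ∪ {y}) + N(f ∪ e),
-- where N(S), the number of 4-subsets of K containing S, is C(6 − |S|, 4 − |S|) if S ⊆ K and 0
-- otherwise. The sizes of f, f ∪ {x}, f ∪ {y}, f ∪ e are 2,2,2,2 if e = f, 2,2,3,3 or 2,3,2,3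
-- if |e ∩ f| = 1, and 2,3,3,4 if e ∩ f = ∅; the sum is 1, 0 and 0 respectively.
module Submission where

open import Defs hiding (sym)
open import Data.Bool using (if_then_else_)
open import Data.Fin using (Fin; zero; suc) renaming (_≟_ to _≟ᶠ_)
open import Data.Fin.Subset using (Subset; _∈_; _∉_; _⊆_; ∣_∣; ⁅_⁆; inside; outside)
open import Data.Fin.Subset.Properties
  using (_∈?_; _⊆?_; ⊆-refl; ⊆-trans; drop-∷-⊆; p⊆q⇒∣p∣≤∣q∣; x∈⁅x⁆; x∈⁅y⁆⇒x≡y; x≢y⇒x∉⁅y⁆; ∣⁅x⁆∣≡1)
import Data.Integer as ℤ
open import Data.List using (List; []; _∷_; map; _++_; filter)
open import Data.List.Properties using (map-∘; map-cong)
import Data.Nat as ℕ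
open import Data.Nat using (ℕ; zero; suc; _≤_; s≤s; _∸_)
open import Data.Nat.Combinatorics using (_C_; nCk+nC[k+1]≡[n+1]C[k+1])
open import Data.Nat.Properties
  using (+-comm; +-suc; suc-injective; 1+n≰n; m∸n+n≡m; m≤n⇒m≤1+n; ≤-reflexive; ≤-trans)
open import Data.Product using (_×_; _,_)
open import Data.Rational using (ℚ; 0ℚ; 1ℚ; ½; _+_; _*_; _/_; -_)
open import Data.Rational.Properties
  using (+-assoc; +-identityˡ; +-identityʳ; *-identityˡ; *-zeroˡ; +-0-monoid)
open import Algebra.Properties.Monoid.Mult +-0-monoid using (×-homo-+) renaming (_×_ to _×ℚ_)
open import Data.Rational.Solver using (module +-*-Solver)
open import Data.Sum using (_⊎_; inj₁; inj₂; [_,_]′; map₂)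
open import Data.Vec using (_∷_; []; here; there; _[_]≔_)
open import Data.Vec.Properties
  using ([]≔-updates; []≔-minimal; []≔-lookup; lookup∘update′; []=⇒lookup; lookup⇒[]=)
open import Function using (_∘_; _⇔_; mk⇔; Equivalence; case_of_)
open import Relation.Binary.PropositionalEquality
  using (_≡_; _≢_; refl; sym; trans; cong; cong₂; subst; _≗_; module ≡-Reasoning)
open import Relation.Nullary using (¬_; Dec; yes; no; does; contradiction; _×-dec_)
open import Relation.Unary using (Decidable)

open ≡-Reasoning
open +-*-Solver using (solve; _:=_; con; _:+_; _:*_)

private
  variable
    n : ℕ
    A : Set
    P Q : Set

𝟙 : Dec P → ℚ
𝟙 d = if does d then 1ℚ else 0ℚ

𝟙-yes : (p : Dec P) → P → 𝟙 p ≡ 1ℚ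
𝟙-yes (yes _) _ = refl
𝟙-yes (no ¬p) p = contradiction p ¬p

𝟙-no : (p : Dec P) → ¬ P → 𝟙 p ≡ 0ℚ
𝟙-no (yes p) ¬p = contradiction p ¬p
𝟙-no (no _)  _  = refl

𝟙-× : (p : Dec P) (q : Dec Q) → 𝟙 (p ×-dec q) ≡ 𝟙 p * 𝟙 q
𝟙-× (yes _) (yes _) = refl
𝟙-× (yes _) (no _)  = refl
𝟙-× (no _)  (yes _) = refl
𝟙-× (no _)  (no _)  = refl

𝟙-⇔ : P ⇔ Q → (p : Dec P) (q : Dec Q) → 𝟙 p ≡ 𝟙 q
𝟙-⇔ _   (yes _) (yes _) = refl
𝟙-⇔ P⇔Q (yes p) (no ¬q) = contradiction (Equivalence.to P⇔Q p) ¬q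
𝟙-⇔ P⇔Q (no ¬p) (yes q) = contradiction (Equivalence.from P⇔Q q) ¬p
𝟙-⇔ _   (no _)  (no _)  = refl

∑ : (A → ℚ) → List A → ℚ
∑ f xs = sumℚ (map f xs)

∑-cong : {f g : A → ℚ} → f ≗ g → ∀ xs → ∑ f xs ≡ ∑ g xs
∑-cong f≗g xs = cong sumℚ (map-cong f≗g xs)

∑-zero : {f : A → ℚ} → (∀ a → f a ≡ 0ℚ) → ∀ xs → ∑ f xs ≡ 0ℚ
∑-zero f≡0 []       = refl
∑-zero f≡0 (x ∷ xs) = cong₂ _+_ (f≡0 x) (∑-zero f≡0 xs)

∑-++ : (f : A → ℚ) → ∀ xs ys → ∑ f (xs ++ ys) ≡ ∑ f xs + ∑ f ys
∑-++ f []       ys = sym (+-identityˡ _)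
∑-++ f (x ∷ xs) ys = trans (cong (f x +_) (∑-++ f xs ys)) (sym (+-assoc (f x) _ _))

∑-map : ∀ {B : Set} (f : B → ℚ) (g : A → B) xs → ∑ f (map g xs) ≡ ∑ (f ∘ g) xs
∑-map f g xs = cong sumℚ (sym (map-∘ xs))

∑-filter : {P : A → Set} (P? : Decidable P) (f : A → ℚ) →
           ∀ xs → ∑ f (filter P? xs) ≡ ∑ (λ a → 𝟙 (P? a) * f a) xs
∑-filter P? f [] = refl
∑-filter P? f (x ∷ xs) with P? x
... | yes _ = cong₂ _+_ (sym (*-identityˡ (f x))) (∑-filter P? f xs)
... | no _  = begin
  ∑ f (filter P? xs)                      ≡⟨ ∑-filter P? f xs ⟩
  ∑ (λ a → 𝟙 (P? a) * f a) xs             ≡⟨ +-identityˡ _ ⟨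
  0ℚ + ∑ (λ a → 𝟙 (P? a) * f a) xs        ≡⟨ cong (_+ _) (*-zeroˡ (f x)) ⟨
  0ℚ * f x + ∑ (λ a → 𝟙 (P? a) * f a) xs  ∎

∑-allSubsets : (f : Subset (suc n) → ℚ) → ∑ f (allSubsets (suc n)) ≡
               ∑ (f ∘ (outside ∷_)) (allSubsets n) + ∑ (f ∘ (inside ∷_)) (allSubsets n)
∑-allSubsets {n} f = trans (∑-++ f (map (outside ∷_) (allSubsets n)) _)
  (cong₂ _+_ (∑-map f (outside ∷_) (allSubsets n)) (∑-map f (inside ∷_) (allSubsets n)))

insert : Fin n → Subset n → Subset n
insert x p = p [ x ]≔ inside

x∈insert : ∀ {x : Fin n} {p} → x ∈ insert x p
x∈insert {x = x} {p} = []≔-updates p x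

∈-insert⁺ : ∀ {x y : Fin n} {p} → y ∈ p → y ∈ insert x p
∈-insert⁺ {x = x} {y} {p} y∈p with y ≟ᶠ x
... | yes refl = x∈insert
... | no y≢x   = []≔-minimal p y x y≢x y∈p

∈-insert⁻ : ∀ {x y : Fin n} {p} → y ∈ insert x p → y ≡ x ⊎ y ∈ p
∈-insert⁻ {x = x} {y} {p} y∈ with y ≟ᶠ x
... | yes y≡x = inj₁ y≡x
... | no y≢x  = inj₂ (lookup⇒[]= y p (trans (sym (lookup∘update′ y≢x p inside)) ([]=⇒lookup y∈)))

insert⊆⇔ : ∀ {x : Fin n} {p q} → insert x p ⊆ q ⇔ (x ∈ q × p ⊆ q)
insert⊆⇔ {x = x} {p} {q} = mk⇔
  (λ xp⊆q → xp⊆q x∈insert , λ {z} z∈p → xp⊆q (∈-insert⁺ z∈p))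
  (λ (x∈q , p⊆q) {z} z∈ →
    [ (λ z≡x → subst (_∈ q) (sym z≡x) x∈q) , (λ z∈p → p⊆q z∈p) ]′ (∈-insert⁻ z∈))

insert-∈ : ∀ {x : Fin n} {p} → x ∈ p → insert x p ≡ p
insert-∈ {x = x} {p} x∈p = trans (cong (p [ x ]≔_) (sym ([]=⇒lookup x∈p))) ([]≔-lookup p x)

∣insert∣-∈ : ∀ {x : Fin n} {p s} → x ∈ p → ∣ p ∣ ≡ s → ∣ insert x p ∣ ≡ s
∣insert∣-∈ x∈p = trans (cong ∣_∣ (insert-∈ x∈p))

∣insert∣-∉ : ∀ {x : Fin n} {p s} → x ∉ p → ∣ p ∣ ≡ s → ∣ insert x p ∣ ≡ suc s
∣insert∣-∉ {x = zero}  {outside ∷ p} x∉p refl = refl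
∣insert∣-∉ {x = zero}  {inside ∷ p}  x∉p _    = contradiction here x∉p
∣insert∣-∉ {x = suc x} {outside ∷ p} x∉p eq   = ∣insert∣-∉ (x∉p ∘ there) eq
∣insert∣-∉ {x = suc x} {inside ∷ p}  x∉p refl = cong suc (∣insert∣-∉ (x∉p ∘ there) refl)

∣insert∣≤ : ∀ {x : Fin n} {p s} → ∣ p ∣ ≤ s → ∣ insert x p ∣ ≤ suc s
∣insert∣≤ {x = x} {p} ∣p∣≤s with x ∈? p
... | yes x∈p = m≤n⇒m≤1+n (subst (_≤ _) (sym (∣insert∣-∈ x∈p refl)) ∣p∣≤s)
... | no x∉p  = subst (_≤ _) (sym (∣insert∣-∉ x∉p refl)) (s≤s ∣p∣≤s)

𝟙-insert⊆ : ∀ (x : Fin n) p q → 𝟙 (insert x p ⊆? q) ≡ 𝟙 (x ∈? q) * 𝟙 (p ⊆? q)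
𝟙-insert⊆ x p q =
  trans (𝟙-⇔ insert⊆⇔ (insert x p ⊆? q) (x ∈? q ×-dec p ⊆? q)) (𝟙-× (x ∈? q) (p ⊆? q))

Layer : Subset n → ℕ → Subset n → Set
Layer K j T = T ⊆ K × ∣ T ∣ ≡ j

layer? : (K : Subset n) (j : ℕ) → Decidable (Layer K j)
layer? K j T = T ⊆? K ×-dec ∣ T ∣ ℕ.≟ j

layerIndicator : Subset n → ℕ → Subset n → Subset n → ℚ
layerIndicator K j S T = 𝟙 (layer? K j T ×-dec S ⊆? T)

layerIndicator-vanishes : ∀ (K : Subset n) j S T → ¬ (Layer K j T × S ⊆ T) →
                          layerIndicator K j S T ≡ 0ℚ
layerIndicator-vanishes K j S T = 𝟙-no (layer? K j T ×-dec S ⊆? T)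

layerCount : Subset n → ℕ → Subset n → ℚ
layerCount {n} K j S = ∑ (layerIndicator K j S) (allSubsets n)

layerCount-⊈ : ∀ {S K : Subset n} {j} → ¬ S ⊆ K → layerCount K j S ≡ 0ℚ
layerCount-⊈ {n} {S} {K} {j} S⊈K = ∑-zero vanishes (allSubsets n)
  where
  vanishes : ∀ T → layerIndicator K j S T ≡ 0ℚ
  vanishes T = layerIndicator-vanishes K j S T λ ((T⊆K , _) , S⊆T) → S⊈K (⊆-trans S⊆T T⊆K)

-- Induction on the first vertex: it is forced out of T (if not in K), forced into T (if in S),
-- or free, in which case the two alternatives are Pascal's rule.
layerCount-⊆ : ∀ {S K : Subset n} m k → S ⊆ K → ∣ K ∣ ≡ m ℕ.+ ∣ S ∣ →
               layerCount K (k ℕ.+ ∣ S ∣) S ≡ (m C k) ×ℚ 1ℚ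
layerCount-⊆ {zero} {[]} {[]} zero zero    _ _ = refl
layerCount-⊆ {zero} {[]} {[]} zero (suc k) _ _ = refl
layerCount-⊆ {suc n} {outside ∷ S} {outside ∷ K} m k S⊆K ∣K∣≡ = begin
  layerCount (outside ∷ K) j (outside ∷ S)
    ≡⟨ ∑-allSubsets (layerIndicator (outside ∷ K) j (outside ∷ S)) ⟩
  layerCount K j S + ∑ (layerIndicator (outside ∷ K) j (outside ∷ S) ∘ (inside ∷_)) (allSubsets n)
    ≡⟨ cong₂ _+_ (layerCount-⊆ m k (drop-∷-⊆ S⊆K) ∣K∣≡) (∑-zero T⊈K (allSubsets n)) ⟩
  (m C k) ×ℚ 1ℚ + 0ℚ
    ≡⟨ +-identityʳ _ ⟩
  (m C k) ×ℚ 1ℚ ∎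
  where
  j = k ℕ.+ ∣ S ∣
  T⊈K : ∀ T → layerIndicator (outside ∷ K) j (outside ∷ S) (inside ∷ T) ≡ 0ℚ
  T⊈K T = layerIndicator-vanishes (outside ∷ K) j (outside ∷ S) (inside ∷ T)
            λ ((T⊆K , _) , _) → case T⊆K here of λ ()
layerCount-⊆ {suc n} {inside ∷ S} {outside ∷ K} m k S⊆K ∣K∣≡ with () ← S⊆K here
layerCount-⊆ {suc n} {inside ∷ S} {inside ∷ K} m k S⊆K ∣K∣≡ rewrite +-suc k ∣ S ∣ = begin
  layerCount (inside ∷ K) (suc j) (inside ∷ S)
    ≡⟨ ∑-allSubsets (layerIndicator (inside ∷ K) (suc j) (inside ∷ S)) ⟩
  ∑ (layerIndicator (inside ∷ K) (suc j) (inside ∷ S) ∘ (outside ∷_)) (allSubsets n) + layerCount K j S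
    ≡⟨ cong₂ _+_ (∑-zero S⊈T (allSubsets n))
                 (layerCount-⊆ m k (drop-∷-⊆ S⊆K) (suc-injective (trans ∣K∣≡ (+-suc m ∣ S ∣)))) ⟩
  0ℚ + (m C k) ×ℚ 1ℚ
    ≡⟨ +-identityˡ _ ⟩
  (m C k) ×ℚ 1ℚ ∎
  where
  j = k ℕ.+ ∣ S ∣
  S⊈T : ∀ T → layerIndicator (inside ∷ K) (suc j) (inside ∷ S) (outside ∷ T) ≡ 0ℚ
  S⊈T T = layerIndicator-vanishes (inside ∷ K) (suc j) (inside ∷ S) (outside ∷ T)
            λ (_ , S⊆T) → case S⊆T here of λ ()
layerCount-⊆ {suc n} {outside ∷ S} {inside ∷ K} zero k S⊆K ∣K∣≡ =
  contradiction (subst (_≤ ∣ K ∣) (sym ∣K∣≡) (p⊆q⇒∣p∣≤∣q∣ (drop-∷-⊆ S⊆K))) 1+n≰n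
layerCount-⊆ {suc n} {outside ∷ S} {inside ∷ K} (suc m) zero S⊆K ∣K∣≡ = begin
  layerCount (inside ∷ K) (∣ S ∣) (outside ∷ S)
    ≡⟨ ∑-allSubsets (layerIndicator (inside ∷ K) (∣ S ∣) (outside ∷ S)) ⟩
  layerCount K (∣ S ∣) S
    + ∑ (layerIndicator (inside ∷ K) (∣ S ∣) (outside ∷ S) ∘ (inside ∷_)) (allSubsets n)
    ≡⟨ cong₂ _+_ (layerCount-⊆ m zero (drop-∷-⊆ S⊆K) (suc-injective ∣K∣≡))
                 (∑-zero T-too-large (allSubsets n)) ⟩
  1ℚ + 0ℚ ∎
  where
  T-too-large : ∀ T → layerIndicator (inside ∷ K) (∣ S ∣) (outside ∷ S) (inside ∷ T) ≡ 0ℚ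
  T-too-large T = layerIndicator-vanishes (inside ∷ K) (∣ S ∣) (outside ∷ S) (inside ∷ T)
    λ ((_ , 1+∣T∣≡∣S∣) , S⊆T) →
      contradiction (subst (_≤ ∣ T ∣) (sym 1+∣T∣≡∣S∣) (p⊆q⇒∣p∣≤∣q∣ (drop-∷-⊆ S⊆T))) 1+n≰n
layerCount-⊆ {suc n} {outside ∷ S} {inside ∷ K} (suc m) (suc k) S⊆K ∣K∣≡ = begin
  layerCount (inside ∷ K) (suc j) (outside ∷ S)
    ≡⟨ ∑-allSubsets (layerIndicator (inside ∷ K) (suc j) (outside ∷ S)) ⟩
  layerCount K (suc j) S + layerCount K j S
    ≡⟨ cong₂ _+_ (layerCount-⊆ m (suc k) S⊆K′ ∣K∣≡′) (layerCount-⊆ m k S⊆K′ ∣K∣≡′) ⟩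
  (m C suc k) ×ℚ 1ℚ + (m C k) ×ℚ 1ℚ
    ≡⟨ ×-homo-+ 1ℚ (m C suc k) (m C k) ⟨
  (m C suc k ℕ.+ m C k) ×ℚ 1ℚ
    ≡⟨ cong (_×ℚ 1ℚ) (trans (+-comm (m C suc k) _) (nCk+nC[k+1]≡[n+1]C[k+1] m k)) ⟩
  (suc m C suc k) ×ℚ 1ℚ ∎
  where
  j = k ℕ.+ ∣ S ∣
  S⊆K′ : S ⊆ K
  S⊆K′ = drop-∷-⊆ S⊆K
  ∣K∣≡′ : ∣ K ∣ ≡ m ℕ.+ ∣ S ∣
  ∣K∣≡′ = suc-injective ∣K∣≡

layerCount-binomial : ∀ {S K : Subset n} {j} → S ⊆ K → ∣ S ∣ ≤ j →
                      layerCount K j S ≡ ((∣ K ∣ ∸ ∣ S ∣) C (j ∸ ∣ S ∣)) ×ℚ 1ℚ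
layerCount-binomial {S = S} {K} {j} S⊆K ∣S∣≤j = begin
  layerCount K j S
    ≡⟨ cong (λ i → layerCount K i S) (m∸n+n≡m ∣S∣≤j) ⟨
  layerCount K (j ∸ ∣ S ∣ ℕ.+ ∣ S ∣) S
    ≡⟨ layerCount-⊆ _ _ S⊆K (sym (m∸n+n≡m (p⊆q⇒∣p∣≤∣q∣ S⊆K))) ⟩
  ((∣ K ∣ ∸ ∣ S ∣) C (j ∸ ∣ S ∣)) ×ℚ 1ℚ ∎

-⅔ : ℚ
-⅔ = - (ℤ.+ 2 / 3)

-- The coefficients invert gadgetValue over the subsets of e = {x, y}:
-- ½ = g 0,  -⅔ = g 1 - g 0,  1 = g 2 - 2 g 1 + g 0.
ie : ℚ → ℚ → ℚ → ℚ → ℚ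
ie a b c d = ½ * a + (-⅔ * b + (-⅔ * c + d))

ie-cong : ∀ {a b c d a′ b′ c′ d′} → a ≡ a′ → b ≡ b′ → c ≡ c′ → d ≡ d′ → ie a b c d ≡ ie a′ b′ c′ d′
ie-cong refl refl refl refl = refl

ie-+ : ∀ a b c d a′ b′ c′ d′ →
       ie a b c d + ie a′ b′ c′ d′ ≡ ie (a + a′) (b + b′) (c + c′) (d + d′)
ie-+ = solve 8 (λ a b c d a′ b′ c′ d′ →
    (con ½ :* a :+ (con -⅔ :* b :+ (con -⅔ :* c :+ d)))
      :+ (con ½ :* a′ :+ (con -⅔ :* b′ :+ (con -⅔ :* c′ :+ d′)))
  := con ½ :* (a :+ a′) :+ (con -⅔ :* (b :+ b′) :+ (con -⅔ :* (c :+ c′) :+ (d :+ d′)))) refl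

*-ie : ∀ r a b c d → r * ie a b c d ≡ ie (r * a) (r * b) (r * c) (r * d)
*-ie = solve 5 (λ r a b c d →
    r :* (con ½ :* a :+ (con -⅔ :* b :+ (con -⅔ :* c :+ d)))
  := con ½ :* (r :* a) :+ (con -⅔ :* (r :* b) :+ (con -⅔ :* (r :* c) :+ r :* d))) refl

∑-ie : (a b c d : A → ℚ) → ∀ xs →
       ∑ (λ t → ie (a t) (b t) (c t) (d t)) xs ≡ ie (∑ a xs) (∑ b xs) (∑ c xs) (∑ d xs)
∑-ie a b c d []       = refl
∑-ie a b c d (x ∷ xs) = trans (cong (ie (a x) (b x) (c x) (d x) +_) (∑-ie a b c d xs))
                              (ie-+ (a x) (b x) (c x) (d x) (∑ a xs) (∑ b xs) (∑ c xs) (∑ d xs))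

gadgetValue-ie : ∀ (x y : Fin n) T →
  gadgetValue (meet x y T) ≡ ie 1ℚ (𝟙 (x ∈? T)) (𝟙 (y ∈? T)) (𝟙 (y ∈? T) * 𝟙 (x ∈? T))
gadgetValue-ie x y T with x ∈? T | y ∈? T
... | yes _ | yes _ = refl
... | yes _ | no _  = refl
... | no _  | yes _ = refl
... | no _  | no _  = refl

ψ≡𝟙*gadgetValue : ∀ (K : Subset n) x y T → ψ K x y T ≡ 𝟙 (T ⊆? K) * gadgetValue (meet x y T)
ψ≡𝟙*gadgetValue K x y T with T ⊆? K
... | yes _ = sym (*-identityˡ (gadgetValue (meet x y T)))
... | no _  = sym (*-zeroˡ (gadgetValue (meet x y T)))

copy×⊆⇔layer : ∀ {G : Graph n} {K T j} → IsClique G K → (IsCopyOfK j G T × T ⊆ K) ⇔ Layer K j T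
copy×⊆⇔layer K-clique = mk⇔
  (λ ((∣T∣≡j , _) , T⊆K) → T⊆K , ∣T∣≡j)
  (λ (T⊆K , ∣T∣≡j) → (∣T∣≡j , λ i j i∈T j∈T i≢j → K-clique i j (T⊆K i∈T) (T⊆K j∈T) i≢j) , T⊆K)

module Gadget (u v x y : Fin n) where

  F Fˣ Fʸ Fˣʸ : Subset n
  F   = insert u ⁅ v ⁆
  Fˣ  = insert x F
  Fʸ  = insert y F
  Fˣʸ = insert y Fˣ

  IE : (Subset n → ℚ) → ℚ
  IE Φ = ie (Φ F) (Φ Fˣ) (Φ Fʸ) (Φ Fˣʸ)

  IE-cong : ∀ {Φ Ψ} → (∀ {S} → F ⊆ S → S ⊆ Fˣʸ → Φ S ≡ Ψ S) → IE Φ ≡ IE Ψ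
  IE-cong Φ≡Ψ =
    ie-cong (Φ≡Ψ ⊆-refl F⊆Fˣʸ) (Φ≡Ψ ∈-insert⁺ ∈-insert⁺) (Φ≡Ψ ∈-insert⁺ Fʸ⊆Fˣʸ) (Φ≡Ψ F⊆Fˣʸ ⊆-refl)
    where
    F⊆Fˣʸ : F ⊆ Fˣʸ
    F⊆Fˣʸ z∈F = ∈-insert⁺ (∈-insert⁺ z∈F)
    Fʸ⊆Fˣʸ : Fʸ ⊆ Fˣʸ
    Fʸ⊆Fˣʸ = Equivalence.from insert⊆⇔ (x∈insert , F⊆Fˣʸ)

  F⊆⇔edge : ∀ {T} → F ⊆ T ⇔ EdgeIn u v T
  F⊆⇔edge {T} = mk⇔
    (λ (F⊆T : F ⊆ T) → F⊆T x∈insert , F⊆T (∈-insert⁺ (x∈⁅x⁆ v)))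
    (λ (u∈T , v∈T) → Equivalence.from insert⊆⇔
      (u∈T , λ {w} w∈⁅v⁆ → subst (_∈ T) (sym (x∈⁅y⁆⇒x≡y v w∈⁅v⁆)) v∈T))

  ∣F∣≡2 : u ≢ v → ∣ F ∣ ≡ 2
  ∣F∣≡2 u≢v = ∣insert∣-∉ (x≢y⇒x∉⁅y⁆ u≢v) (∣⁅x⁆∣≡1 v)

  x,y∈F⇔f≡e : x ≢ y → (x ∈ F × y ∈ F) ⇔ ((u ≡ x × v ≡ y) ⊎ (u ≡ y × v ≡ x))
  x,y∈F⇔f≡e x≢y = mk⇔ (λ (x∈F , y∈F) → endpoints (∈F⁻ x∈F) (∈F⁻ y∈F)) λ where
      (inj₁ (refl , refl)) → x∈insert , ∈-insert⁺ (x∈⁅x⁆ v)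
      (inj₂ (refl , refl)) → ∈-insert⁺ (x∈⁅x⁆ v) , x∈insert
    where
    ∈F⁻ : ∀ {z} → z ∈ F → z ≡ u ⊎ z ≡ v
    ∈F⁻ z∈F = map₂ (x∈⁅y⁆⇒x≡y v) (∈-insert⁻ z∈F)
    endpoints : x ≡ u ⊎ x ≡ v → y ≡ u ⊎ y ≡ v → (u ≡ x × v ≡ y) ⊎ (u ≡ y × v ≡ x)
    endpoints (inj₁ refl) (inj₁ refl) = contradiction refl x≢y
    endpoints (inj₁ refl) (inj₂ refl) = inj₁ (refl , refl)
    endpoints (inj₂ refl) (inj₁ refl) = inj₂ (refl , refl)
    endpoints (inj₂ refl) (inj₂ refl) = contradiction refl x≢y

  edge-gadget-IE : ∀ T → 𝟙 (edgeIn? u v T) * gadgetValue (meet x y T) ≡ IE (λ S → 𝟙 (S ⊆? T))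
  edge-gadget-IE T = begin
    e * gadgetValue (meet x y T)        ≡⟨ cong (e *_) (gadgetValue-ie x y T) ⟩
    e * ie 1ℚ p q (q * p)               ≡⟨ distribute e p q ⟩
    ie e (p * e) (q * e) (q * (p * e))  ≡⟨ ie-cong σF σFˣ σFʸ σFˣʸ ⟨
    IE (λ S → 𝟙 (S ⊆? T))               ∎
    where
    e = 𝟙 (edgeIn? u v T)
    p = 𝟙 (x ∈? T)
    q = 𝟙 (y ∈? T)
    distribute : ∀ e p q → e * ie 1ℚ p q (q * p) ≡ ie e (p * e) (q * e) (q * (p * e))
    distribute = solve 3 (λ e p q →
        e :* (con ½ :* con 1ℚ :+ (con -⅔ :* p :+ (con -⅔ :* q :+ q :* p)))
      := con ½ :* e :+ (con -⅔ :* (p :* e) :+ (con -⅔ :* (q :* e) :+ q :* (p :* e)))) refl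
    σF : 𝟙 (F ⊆? T) ≡ e
    σF = 𝟙-⇔ F⊆⇔edge (F ⊆? T) (edgeIn? u v T)
    σFˣ : 𝟙 (Fˣ ⊆? T) ≡ p * e
    σFˣ = trans (𝟙-insert⊆ x F T) (cong (p *_) σF)
    σFʸ : 𝟙 (Fʸ ⊆? T) ≡ q * e
    σFʸ = trans (𝟙-insert⊆ y F T) (cong (q *_) σF)
    σFˣʸ : 𝟙 (Fˣʸ ⊆? T) ≡ q * (p * e)
    σFˣʸ = trans (𝟙-insert⊆ y Fˣ T) (cong (q *_) σFˣ)

  binomial₆₄ : ℕ → ℚ
  binomial₆₄ s = ((6 ∸ s) C (4 ∸ s)) ×ℚ 1ℚ

  IE-binomial₆₄ : u ≢ v → x ≢ y → IE (binomial₆₄ ∘ ∣_∣) ≡ 𝟙 (x ∈? F ×-dec y ∈? F)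
  IE-binomial₆₄ u≢v x≢y = by-cases (x ∈? F) (y ∈? F)
    where
    ∣F∣ : ∣ F ∣ ≡ 2
    ∣F∣ = ∣F∣≡2 u≢v
    y∉Fˣ : y ∉ F → y ∉ Fˣ
    y∉Fˣ y∉F y∈Fˣ = [ x≢y ∘ sym , y∉F ]′ (∈-insert⁻ y∈Fˣ)
    by-size : ∀ {a b c} → ∣ Fˣ ∣ ≡ a → ∣ Fʸ ∣ ≡ b → ∣ Fˣʸ ∣ ≡ c →
              IE (binomial₆₄ ∘ ∣_∣) ≡ ie (binomial₆₄ 2) (binomial₆₄ a) (binomial₆₄ b) (binomial₆₄ c)
    by-size ∣Fˣ∣ ∣Fʸ∣ ∣Fˣʸ∣ = ie-cong (cong binomial₆₄ ∣F∣) (cong binomial₆₄ ∣Fˣ∣)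
                                     (cong binomial₆₄ ∣Fʸ∣) (cong binomial₆₄ ∣Fˣʸ∣)
    by-cases : (x∈?F : Dec (x ∈ F)) (y∈?F : Dec (y ∈ F)) →
               IE (binomial₆₄ ∘ ∣_∣) ≡ 𝟙 (x∈?F ×-dec y∈?F)
    by-cases (yes x∈F) (yes y∈F) = by-size (∣insert∣-∈ x∈F ∣F∣) (∣insert∣-∈ y∈F ∣F∣)
                                           (∣insert∣-∈ (∈-insert⁺ y∈F) (∣insert∣-∈ x∈F ∣F∣))
    by-cases (yes x∈F) (no y∉F)  = by-size (∣insert∣-∈ x∈F ∣F∣) (∣insert∣-∉ y∉F ∣F∣)
                                           (∣insert∣-∉ (y∉Fˣ y∉F) (∣insert∣-∈ x∈F ∣F∣))
    by-cases (no x∉F)  (yes y∈F) = by-size (∣insert∣-∉ x∉F ∣F∣) (∣insert∣-∈ y∈F ∣F∣)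
                                           (∣insert∣-∈ (∈-insert⁺ y∈F) (∣insert∣-∉ x∉F ∣F∣))
    by-cases (no x∉F)  (no y∉F)  = by-size (∣insert∣-∉ x∉F ∣F∣) (∣insert∣-∉ y∉F ∣F∣)
                                           (∣insert∣-∉ (y∉Fˣ y∉F) (∣insert∣-∉ x∉F ∣F∣))

module _ (G : Graph n) (K : Subset n) (x y u v : Fin n) where
  open Gadget u v x y

  restrict-to-layer : IsClique G K → ∀ T →
    𝟙 (isCopyOfK? 4 G T) * (𝟙 (edgeIn? u v T) * ψ K x y T) ≡
    𝟙 (layer? K 4 T) * (𝟙 (edgeIn? u v T) * gadgetValue (meet x y T))
  restrict-to-layer K-clique T = begin
    c * (e * ψ K x y T)
      ≡⟨ cong (λ z → c * (e * z)) (ψ≡𝟙*gadgetValue K x y T) ⟩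
    c * (e * (s * g))
      ≡⟨ regroup c e s g ⟩
    (c * s) * (e * g)
      ≡⟨ cong (_* (e * g)) (𝟙-× (isCopyOfK? 4 G T) (T ⊆? K)) ⟨
    𝟙 (isCopyOfK? 4 G T ×-dec T ⊆? K) * (e * g)
      ≡⟨ cong (_* (e * g)) (𝟙-⇔ (copy×⊆⇔layer {G = G} K-clique) (isCopyOfK? 4 G T ×-dec T ⊆? K)
                                                                  (layer? K 4 T)) ⟩
    𝟙 (layer? K 4 T) * (e * g) ∎
    where
    c = 𝟙 (isCopyOfK? 4 G T)
    e = 𝟙 (edgeIn? u v T)
    s = 𝟙 (T ⊆? K)
    g = gadgetValue (meet x y T)
    regroup : ∀ c e s g → c * (e * (s * g)) ≡ (c * s) * (e * g)
    regroup = solve 4 (λ c e s g → c :* (e :* (s :* g)) := (c :* s) :* (e :* g)) refl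

  gadgetSum-IE : IsClique G K → gadgetSum G K x y u v ≡ IE (layerCount K 4)
  gadgetSum-IE K-clique = begin
    gadgetSum G K x y u v
      ≡⟨ ∑-filter (edgeIn? u v) (ψ K x y) (K4s G) ⟩
    ∑ (λ T → 𝟙 (edgeIn? u v T) * ψ K x y T) (K4s G)
      ≡⟨ ∑-filter (isCopyOfK? 4 G) _ (allSubsets n) ⟩
    ∑ (λ T → 𝟙 (isCopyOfK? 4 G T) * (𝟙 (edgeIn? u v T) * ψ K x y T)) (allSubsets n)
      ≡⟨ ∑-cong summand (allSubsets n) ⟩
    ∑ (λ T → IE (λ S → layerIndicator K 4 S T)) (allSubsets n)
      ≡⟨ ∑-ie _ _ _ _ (allSubsets n) ⟩
    IE (layerCount K 4) ∎
    where
    summand : ∀ T → 𝟙 (isCopyOfK? 4 G T) * (𝟙 (edgeIn? u v T) * ψ K x y T) ≡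
                    IE (λ S → layerIndicator K 4 S T)
    summand T = begin
      𝟙 (isCopyOfK? 4 G T) * (𝟙 (edgeIn? u v T) * ψ K x y T)
        ≡⟨ restrict-to-layer K-clique T ⟩
      𝟙 (layer? K 4 T) * (𝟙 (edgeIn? u v T) * gadgetValue (meet x y T))
        ≡⟨ cong (𝟙 (layer? K 4 T) *_) (edge-gadget-IE T) ⟩
      𝟙 (layer? K 4 T) * IE (λ S → 𝟙 (S ⊆? T))
        ≡⟨ *-ie (𝟙 (layer? K 4 T)) (𝟙 (F ⊆? T)) (𝟙 (Fˣ ⊆? T)) (𝟙 (Fʸ ⊆? T)) (𝟙 (Fˣʸ ⊆? T)) ⟩
      IE (λ S → 𝟙 (layer? K 4 T) * 𝟙 (S ⊆? T))
        ≡⟨ IE-cong (λ {S} _ _ → 𝟙-× (layer? K 4 T) (S ⊆? T)) ⟨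
      IE (λ S → layerIndicator K 4 S T) ∎

  gadgetSum≡𝟙[e⊆f] : IsCopyOfK 6 G K → x ∈ K → y ∈ K → x ≢ y → u ≢ v →
                     gadgetSum G K x y u v ≡ 𝟙 (x ∈? F ×-dec y ∈? F)
  gadgetSum≡𝟙[e⊆f] (∣K∣≡6 , K-clique) x∈K y∈K x≢y u≢v with F ⊆? K
  ... | yes F⊆K = begin
    gadgetSum G K x y u v    ≡⟨ gadgetSum-IE K-clique ⟩
    IE (layerCount K 4)      ≡⟨ IE-cong count ⟩
    IE (binomial₆₄ ∘ ∣_∣)    ≡⟨ IE-binomial₆₄ u≢v x≢y ⟩
    𝟙 (x ∈? F ×-dec y ∈? F)  ∎
    where
    Fˣʸ⊆K : Fˣʸ ⊆ K
    Fˣʸ⊆K = Equivalence.from insert⊆⇔ (y∈K , Equivalence.from insert⊆⇔ (x∈K , F⊆K))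
    ∣Fˣʸ∣≤4 : ∣ Fˣʸ ∣ ≤ 4
    ∣Fˣʸ∣≤4 = ∣insert∣≤ {x = y} {Fˣ} (∣insert∣≤ {x = x} {F} (≤-reflexive (∣F∣≡2 u≢v)))
    count : ∀ {S} → F ⊆ S → S ⊆ Fˣʸ → layerCount K 4 S ≡ binomial₆₄ ∣ S ∣
    count {S} _ S⊆Fˣʸ = begin
      layerCount K 4 S
        ≡⟨ layerCount-binomial (⊆-trans S⊆Fˣʸ Fˣʸ⊆K) (≤-trans (p⊆q⇒∣p∣≤∣q∣ S⊆Fˣʸ) ∣Fˣʸ∣≤4) ⟩
      ((∣ K ∣ ∸ ∣ S ∣) C (4 ∸ ∣ S ∣)) ×ℚ 1ℚ
        ≡⟨ cong (λ κ → ((κ ∸ ∣ S ∣) C (4 ∸ ∣ S ∣)) ×ℚ 1ℚ) ∣K∣≡6 ⟩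
      binomial₆₄ ∣ S ∣ ∎
  ... | no F⊈K = begin
    gadgetSum G K x y u v    ≡⟨ gadgetSum-IE K-clique ⟩
    IE (layerCount K 4)      ≡⟨ IE-cong (λ F⊆S _ → layerCount-⊈ λ S⊆K → F⊈K (⊆-trans F⊆S S⊆K)) ⟩
    0ℚ                       ≡⟨ 𝟙-no (x ∈? F ×-dec y ∈? F) (F⊈K ∘ F⊆K) ⟨
    𝟙 (x ∈? F ×-dec y ∈? F)  ∎
    where
    F⊆K : x ∈ F × y ∈ F → F ⊆ K
    F⊆K x,y∈F with Equivalence.to (x,y∈F⇔f≡e x≢y) x,y∈F
    ... | inj₁ (refl , refl) = Equivalence.from F⊆⇔edge (x∈K , y∈K)
    ... | inj₂ (refl , refl) = Equivalence.from F⊆⇔edge (y∈K , x∈K)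

lemma2p1 : ∀ {n} (G : Graph n) (K : Subset n) → IsCopyOfK 6 G K →
           (x y : Fin n) → x ∈ K → y ∈ K → ¬ x ≡ y →
           (u v : Fin n) → Adj G u v →
           (((u ≡ x × v ≡ y) ⊎ (u ≡ y × v ≡ x)) → gadgetSum G K x y u v ≡ 1ℚ)
           × (¬ ((u ≡ x × v ≡ y) ⊎ (u ≡ y × v ≡ x)) → gadgetSum G K x y u v ≡ 0ℚ)
lemma2p1 G K K-copy x y x∈K y∈K x≢y u v uv =
    (λ f≡e → trans sum≡𝟙 (𝟙-yes (x ∈? F ×-dec y ∈? F) (from f≡e)))
  , (λ f≢e → trans sum≡𝟙 (𝟙-no (x ∈? F ×-dec y ∈? F) (f≢e ∘ to)))
  where
  open Gadget u v x y
  open Equivalence (x,y∈F⇔f≡e x≢y)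
  u≢v : u ≢ v
  u≢v u≡v = irrefl G (subst (Adj G u) (sym u≡v) uv)
  sum≡𝟙 : gadgetSum G K x y u v ≡ 𝟙 (x ∈? F ×-dec y ∈? F)
  sum≡𝟙 = gadgetSum≡𝟙[e⊆f] G K x y u v K-copy x∈K y∈K x≢y u≢v
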